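{- For any game instance $Z$, any quantum flavor $\phi\in\{A,B,C,C',D\}$ and any superposition width $w\ge2$, the game tree of the quantum lift $Z^{\mathcal Q(\phi,w)}$ is not taller than the game tree of $Z$.
   Context: A game instance $Z=(B,\Sigma,\rho_L,\rho_R,b_0)$ has positions $B$, moves $\Sigma$, move functions $\rho_L,\rho_R:B\times\Sigma\to B\cup\{\mathrm{NULL}\}$ and start $b_0$. Its game tree has root $b_0$, and the children of a node are the results of the current player's legal moves; leaves are positions with no legal move; the height is the length of the longest play. Quantum lift $Z^{\mathcal Q(\phi,w)}$: quantum moves are superpositions of $2\le w'\le w$ distinct classical moves; quantum positions are superpositions of distinct classical positions (realizations). A classical move maps $\langle b_1\mid\cdots\mid b_s\rangle$ to the superposition of distinct non-NULL $\rho_h(b_i,\sigma)$; a quantum move $\langle\sigma_1\mid\cdots\mid\sigma_{w'}\rangle$ maps it to the superposition of distinct non-NULL $\rho_h(b_i,\sigma_j)$. A quantum move is legal only if each $\sigma_j$ is feasible in some realization. Flavors: D — any classical move feasible in some realization is allowed; C' — classical moves allowed only if feasible in every non-terminal realization; C — only if feasible in every realization; B — classical moves only if no legal quantum move exists; A — no classical moves. -}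

module Defs where

open import Data.Nat using (ℕ; zero; suc; _≤_)
open import Data.Maybe using (Maybe; just; nothing)
open import Data.List using (List; []; _∷_; length)
open import Data.List.Membership.Propositional using (_∈_)
open import Data.List.Relation.Unary.All using (All)
open import Data.List.Relation.Unary.Any using (Any)
open import Data.List.Relation.Unary.Unique.Propositional using (Unique)
open import Data.Product using (Σ; ∃; _×_)
open import Data.Sum using (_⊎_)
open import Data.Empty using (⊥)
open import Relation.Nullary using (¬_)
open import Relation.Binary.PropositionalEquality using (_≡_)

data Player : Set where
  Left Right : Player

other : Player → Player
other Left  = Right
other Right = Left

-- A game instance Z = (B, Σ, ρ_L, ρ_R, b₀); NULL is 'nothing'.
record Game : Set₁ where
  field
    Pos   : Set
    Move  : Set
    ρL    : Pos → Move → Maybe Pos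
    ρR    : Pos → Move → Maybe Pos
    start : Pos

  ρ : Player → Pos → Move → Maybe Pos
  ρ Left  = ρL
  ρ Right = ρR

  Feasible : Player → Pos → Move → Set
  Feasible h b σ = ∃ λ b' → ρ h b σ ≡ just b'

  Terminal : Player → Pos → Set
  Terminal h b = ∀ σ → ¬ Feasible h b σ

  -- Game tree of Z: 'CPlay h b n' means there is a play of length n
  -- starting in b with player h to move (players alternate).
  data CPlay : Player → Pos → ℕ → Set where
    cstop : ∀ {h b} → CPlay h b zero
    cmove : ∀ {h b n} (σ : Move) (b' : Pos) → ρ h b σ ≡ just b' →
            CPlay (other h) b' n → CPlay h b (suc n)

open Game public

data Flavor : Set where
  A B C C' D : Flavor

module _ (G : Game) where
  open Game G using () renaming (Pos to P; Move to M)

  -- A quantum position is a list of pairwise distinct classical positions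
  -- (its realizations); a move of the quantum game is a list of moves
  -- (singleton = classical move, length 2..w distinct = quantum move).

  FeasibleSome : Player → List P → M → Set
  FeasibleSome h Q σ = Any (λ b → Feasible G h b σ) Q

  LegalQuantum : ℕ → Player → List P → List M → Set
  LegalQuantum w h Q ms =
    Unique ms × 2 ≤ length ms × length ms ≤ w × All (FeasibleSome h Q) ms

  LegalClassical : Flavor → ℕ → Player → List P → M → Set
  LegalClassical A  w h Q σ = ⊥
  LegalClassical B  w h Q σ =
    FeasibleSome h Q σ × ¬ (∃ λ ms → LegalQuantum w h Q ms)
  LegalClassical C  w h Q σ =
    FeasibleSome h Q σ × All (λ b → Feasible G h b σ) Q
  LegalClassical C' w h Q σ =
    FeasibleSome h Q σ × All (λ b → ¬ Terminal G h b → Feasible G h b σ) Q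
  LegalClassical D  w h Q σ = FeasibleSome h Q σ

  Result : Player → List P → List M → List P → Set
  Result h Q ms Q' =
    Unique Q' ×
    (∀ x → (x ∈ Q' → ∃ λ b → ∃ λ σ → b ∈ Q × σ ∈ ms × ρ G h b σ ≡ just x)
         × ((∃ λ b → ∃ λ σ → b ∈ Q × σ ∈ ms × ρ G h b σ ≡ just x) → x ∈ Q'))

  QStep : Flavor → ℕ → Player → List P → List P → Set
  QStep φ w h Q Q' =
    (∃ λ σ → LegalClassical φ w h Q σ × Result h Q (σ ∷ []) Q')
    ⊎ (∃ λ ms → LegalQuantum w h Q ms × Result h Q ms Q')

  data QPlay (φ : Flavor) (w : ℕ) : Player → List P → ℕ → Set where
    qstop : ∀ {h Q} → QPlay φ w h Q zero
    qmove : ∀ {h Q n} (Q' : List P) → QStep φ w h Q Q' →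
            QPlay φ w (other h) Q' n → QPlay φ w h Q (suc n)

-- Every realization x of the position after a quantum move is ρ_h(b, σ) = x for
-- some realization b before it, and every step of the lift uses at least one
-- feasible move, so the next position is non-empty. Reading a quantum play
-- backwards therefore threads a classical play of the same length through one
-- realization per step, ending in the only realization b₀ of the start.
{-# OPTIONS --safe #-}
module Submission where

open import Defs
open import Data.Nat using (ℕ; _≤_; suc)
open import Data.List using (List; []; _∷_)
open import Data.List.Relation.Unary.Any using (Any; here)
open import Data.List.Relation.Unary.All using (_∷_)
open import Data.List.Membership.Propositional using (_∈_; find; lose)
open import Data.Product using (∃; _×_; _,_; proj₁; proj₂)
open import Data.Sum using (inj₁; inj₂)
open import Relation.Binary.PropositionalEquality using (refl)

module _ (G : Game) where
  open Game G using () renaming (Pos to P)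

  AnyCPlay : Player → List P → ℕ → Set
  AnyCPlay h Q n = Any (λ b → CPlay G h b n) Q

  QStep⇒Result : ∀ {φ w h Q Q'} → QStep G φ w h Q Q' →
                 ∃ λ ms → Result G h Q ms Q' × Any (FeasibleSome G h Q) ms
  QStep⇒Result {A}  (inj₁ (σ , () , _))
  QStep⇒Result {B}  (inj₁ (σ , (σ-feas , _) , res)) = σ ∷ [] , res , here σ-feas
  QStep⇒Result {C}  (inj₁ (σ , (σ-feas , _) , res)) = σ ∷ [] , res , here σ-feas
  QStep⇒Result {C'} (inj₁ (σ , (σ-feas , _) , res)) = σ ∷ [] , res , here σ-feas
  QStep⇒Result {D}  (inj₁ (σ , σ-feas , res))       = σ ∷ [] , res , here σ-feas
  QStep⇒Result (inj₂ (σ ∷ ms , (_ , _ , _ , σ-feas ∷ _) , res)) =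
    σ ∷ ms , res , here σ-feas

  Result-nonempty : ∀ {h Q ms Q'} → Result G h Q ms Q' →
                    Any (FeasibleSome G h Q) ms → ∃ λ x → x ∈ Q'
  Result-nonempty (_ , complete) feasible with find feasible
  ... | σ , σ∈ms , σ-feas with find σ-feas
  ...   | b , b∈Q , (x , ρbσ≡x) =
    x , proj₂ (complete x) (b , σ , b∈Q , σ∈ms , ρbσ≡x)

  Result-pullback : ∀ {h Q ms Q' n} → Result G h Q ms Q' →
                    AnyCPlay (other h) Q' n → AnyCPlay h Q (suc n)
  Result-pullback (_ , complete) plays with find plays
  ... | x , x∈Q' , play with proj₁ (complete x) x∈Q'
  ...   | b , σ , b∈Q , _ , ρbσ≡x = lose b∈Q (cmove σ x ρbσ≡x play)

  QPlay⇒AnyCPlay : ∀ {φ w h Q n x} → QPlay G φ w h Q n → x ∈ Q → AnyCPlay h Q n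
  QPlay⇒AnyCPlay qstop x∈Q = lose x∈Q cstop
  QPlay⇒AnyCPlay {h = h} (qmove Q' step play) _ with QStep⇒Result step
  ... | ms , res , feasible with Result-nonempty {h} res feasible
  ...   | _ , x'∈Q' = Result-pullback {h} res (QPlay⇒AnyCPlay play x'∈Q')

mainTheorem15 : (G : Game) (φ : Flavor) (w : ℕ) → 2 ≤ w →
    (h : Player) (n : ℕ) →
    QPlay G φ w h (start G ∷ []) n → CPlay G h (start G) n
mainTheorem15 G φ w _ h n play with QPlay⇒AnyCPlay G play (here refl)
... | here classical = classical
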